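{- Let $G=(A\cup B,E)$ with $|A|=|B|=n$, let $M$ be an assignment with $\mu(M)\le k$ and let $\vec\alpha$ be a dual certificate for $M$. Consider the level function $\ell_{\vec\alpha}:B\to\mathbb{N}$ with $\ell_{\vec\alpha}(b)=-\alpha_b$. Then every edge $e=(a,b)\in M$ with load $\lambda=\alpha_a+\alpha_b$ is $\lambda$-feasible with respect to $\ell_{\vec\alpha}$.
   Context: Each agent $a\in A$ has a strict partial order $\succ_a$ over her neighbors; an assignment is a perfect matching. For $(a,b)\in E$: $\mathsf{wt}_M(a,b)=1$ if $b\succ_aM(a)$, $-1$ if $M(a)\succ_ab$, $0$ otherwise. $\mu(M)=\max_N\Delta(N,M)$ over perfect matchings $N$, where $\Delta(N,M)$ is the number of agents with $N(a)\succ_aM(a)$ minus the number with $M(a)\succ_aN(a)$. A dual certificate for $M$ with $\mu(M)\le k$ is a feasible solution $\vec\alpha$ of the LP $\min\sum_u y_u$ s.t. $y_a+y_b\ge\mathsf{wt}_M(a,b)$ for all $(a,b)\in E$, with $\alpha_a\in\{0,1,\dots,n\}$ for $a\in A$, $\alpha_b\in\{0,-1,\dots,-(n-1)\}$ for $b\in B$ and $\sum_u\alpha_u\le k$. Given $\ell:B\to\mathbb{N}$, let $\ell^*(a)=\max_{b\in\mathsf{Nbr}(a)}\ell(b)$. For $\lambda\in\mathbb{N}$, edge $(a,b)$ is $\lambda$-feasible if (i) $\ell(b)\ge\ell^*(a)-\lambda+1$; or (ii) $\ell(b)=\ell^*(a)-\lambda$ and $a$ has no neighbor $b'$ with $\ell(b')=\ell^*(a)$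 and $b'\succ_ab$; or (iii) $\ell(b)=\ell^*(a)-\lambda-1$, $b\succ_ab'$ for every neighbor $b'$ of $a$ with $\ell(b')=\ell^*(a)$, and $a$ has no neighbor $b''$ with $\ell(b'')=\ell^*(a)-1$ and $b''\succ_ab$. -}

module Defs where

open import Data.Bool using (Bool; true; false; if_then_else_; T)
open import Data.Nat as ℕ using (ℕ; _⊔_)
open import Data.Integer as ℤ using (ℤ; +_; -_; _+_; _-_; _≤_; ∣_∣)
open import Data.Fin using (Fin)
open import Data.List using (List; foldr; map; allFin)
open import Data.Sum using (_⊎_)
open import Data.Product using (Σ; ∃; _×_; _,_)
open import Relation.Nullary using (¬_)
open import Relation.Binary.PropositionalEquality using (_≡_)
open import Function.Definitions using (Injective)

-- A one-sided bipartite instance G = (A ∪ B, E) with |A| = |B| = n.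
-- A = Fin n (agents), B = Fin n (items).
-- edge a b = true  iff (a , b) ∈ E.
-- pref a b b' = true  iff  b ≻_a b'.
record Instance (n : ℕ) : Set where
  field
    edge : Fin n → Fin n → Bool
    pref : Fin n → Fin n → Fin n → Bool
    pref-nbrˡ : ∀ a b b' → T (pref a b b') → T (edge a b)
    pref-nbrʳ : ∀ a b b' → T (pref a b b') → T (edge a b')
    pref-irrefl : ∀ a b → ¬ T (pref a b b)
    pref-trans : ∀ a b b' b'' → T (pref a b b') → T (pref a b' b'') → T (pref a b b'')

module _ {n : ℕ} (G : Instance n) where
  open Instance G

  record Assignment : Set where
    field
      match : Fin n → Fin n
      match-edge : ∀ a → T (edge a (match a))
      match-inj : Injective _≡_ _≡_ match

  sumℤ : List ℤ → ℤ
  sumℤ = foldr _+_ (+ 0)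

  count : (Fin n → Bool) → ℕ
  count p = foldr ℕ._+_ 0 (map (λ a → if p a then 1 else 0) (allFin n))

  Δ : Assignment → Assignment → ℤ
  Δ N M = + count (λ a → pref a (Assignment.match N a) (Assignment.match M a))
        - + count (λ a → pref a (Assignment.match M a) (Assignment.match N a))

  μ≤ : Assignment → ℤ → Set
  μ≤ M k = ∀ (N : Assignment) → Δ N M ≤ k

  wt : Assignment → Fin n → Fin n → ℤ
  wt M a b = if pref a b (Assignment.match M a) then + 1
             else (if pref a (Assignment.match M a) b then - (+ 1) else + 0)

  record DualCertificate (M : Assignment) (k : ℤ) : Set where
    field
      αA : Fin n → ℤ
      αB : Fin n → ℤ
      feasible : ∀ a b → T (edge a b) → wt M a b ≤ αA a + αB b
      αA-range : ∀ a → + 0 ≤ αA a × αA a ≤ + n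
      αB-range : ∀ b → - (+ (n ℕ.∸ 1)) ≤ αB b × αB b ≤ + 0
      sum≤k : sumℤ (map αA (allFin n)) + sumℤ (map αB (allFin n)) ≤ k

  -- ℓ*(a) = max_{b ∈ Nbr(a)} ℓ(b)   (0 if a has no neighbour; irrelevant here)
  ℓ* : (Fin n → ℕ) → Fin n → ℕ
  ℓ* ℓ a = foldr _⊔_ 0 (map (λ b → if edge a b then ℓ b else 0) (allFin n))

  Feasible : (Fin n → ℕ) → ℕ → Fin n → Fin n → Set
  Feasible ℓ λ' a b =
      (+ ℓ* ℓ a - + λ' + + 1 ≤ + ℓ b)
    ⊎ ((+ ℓ b ≡ + ℓ* ℓ a - + λ')
        × ¬ (∃ λ b' → T (edge a b') × ℓ b' ≡ ℓ* ℓ a × T (pref a b' b)))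
    ⊎ ((+ ℓ b ≡ + ℓ* ℓ a - + λ' - + 1)
        × (∀ b' → T (edge a b') → ℓ b' ≡ ℓ* ℓ a → T (pref a b b'))
        × ¬ (∃ λ b'' → T (edge a b'') × + ℓ b'' ≡ + ℓ* ℓ a - + 1 × T (pref a b'' b)))

  -- level function ℓ_α(b) = -α_b  (a natural number, since α_b ≤ 0)
  level : {M : Assignment} {k : ℤ} → DualCertificate M k → Fin n → ℕ
  level α b = ∣ - DualCertificate.αB α b ∣

module Submission where

open import Defs
open import Data.Nat using (ℕ)
open import Data.Integer using (ℤ; +_; _+_)
open import Data.Fin using (Fin)
open import Relation.Binary.PropositionalEquality using (_≡_)
open import Data.Bool using (Bool; true; false; if_then_else_; T)
open import Data.Unit using (tt)
open import Data.Empty using (⊥-elim)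
open import Data.Nat as ℕ using (suc; zero; z≤n; s≤s)
open import Relation.Binary.Definitions using (tri<; tri≈; tri>)
import Data.Nat.Properties as ℕ
open import Data.Integer as ℤ using (-_; _-_; +≤+; ∣_∣)
import Data.Integer.Properties as ℤ
open import Data.Integer.Tactic.RingSolver using (solve-∀)
open import Data.List using (map; allFin)
open import Data.List.Properties using (foldr-preservesᵇ)
open import Data.List.Relation.Unary.All using (universal)
open import Data.List.Relation.Unary.All.Properties using (map⁺)
open import Data.Sum using (inj₁; inj₂)
open import Data.Product using (_,_; proj₁; proj₂; ∃; _×_)
open import Relation.Binary.PropositionalEquality using (refl; sym; trans; cong; cong₂; subst; module ≡-Reasoning)
open import Relation.Nullary using (¬_)

-- Write m = α_a and ℓ = ℓ_α, so that λ + ℓ(M(a)) = m. Dual feasibility on an edge (a, b') says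
-- wt_M(a, b') + ℓ(b') ≤ m: every neighbour of a has level at most m + 1, at most m unless
-- M(a) ≻_a b', and at most m - 1 if b' ≻_a M(a). Hence ℓ*(a) ≤ m + 1, and the three cases
-- ℓ*(a) < m, ℓ*(a) = m, ℓ*(a) = m + 1 yield conditions (i), (ii) and (iii) respectively.

-- wt G M a b is definitionally weight (pref a b (M a)) (pref a (M a) b).
weight : Bool → Bool → ℤ
weight improves worsens = if improves then + 1 else (if worsens then - + 1 else + 0)

weight+≤⇒< : ∀ x y {l m} → weight x y + + l ℤ.≤ + m → T x → l ℕ.< m
weight+≤⇒< true _ (+≤+ 1+l≤m) _ = 1+l≤m

weight+≤⇒≤ : ∀ x y {l m} → weight x y + + l ℤ.≤ + m → ¬ T y → l ℕ.≤ m
weight+≤⇒≤ true  y     h       _  = ℕ.<⇒≤ (weight+≤⇒< true y h tt)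
weight+≤⇒≤ false false (+≤+ h) _  = h
weight+≤⇒≤ false true  _       ¬y = ⊥-elim (¬y tt)

weight+≤⇒≤1+ : ∀ x y {l m} → weight x y + + l ℤ.≤ + m → l ℕ.≤ suc m
weight+≤⇒≤1+ true  y     h               = ℕ.m≤n⇒m≤1+n (ℕ.<⇒≤ (weight+≤⇒< true y h tt))
weight+≤⇒≤1+ false false h               = ℕ.m≤n⇒m≤1+n (weight+≤⇒≤ false false h λ ())
weight+≤⇒≤1+ false true  {zero}  _       = z≤n
weight+≤⇒≤1+ false true  {suc l} (+≤+ h) = s≤s h

m≡n+o⇒+m-+n≡+o : ∀ {m} n {o} → m ≡ n ℕ.+ o → + m - + n ≡ + o
m≡n+o⇒+m-+n≡+o n {o} refl = i+j-i≡j (+ n) (+ o)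
  where
  i+j-i≡j : ∀ i j → i + j - i ≡ j
  i+j-i≡j = solve-∀

i-j+j≡i : ∀ i j → i - j + j ≡ i
i-j+j≡i = solve-∀

m<n+o⇒+m-+n+1≤+o : ∀ {m n o} → m ℕ.< n ℕ.+ o → + m - + n + + 1 ℤ.≤ + o
m<n+o⇒+m-+n+1≤+o {m} {n} {o} m<n+o = begin
  + m - + n + + 1     ≡⟨ i-j+1≡1+i-j (+ m) (+ n) ⟩
  + suc m - + n       ≤⟨ ℤ.+-monoˡ-≤ (- + n) (+≤+ m<n+o) ⟩
  + (n ℕ.+ o) - + n   ≡⟨ m≡n+o⇒+m-+n≡+o n refl ⟩
  + o                 ∎
  where
  open ℤ.≤-Reasoning
  i-j+1≡1+i-j : ∀ i j → i - j + + 1 ≡ + 1 + i - j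
  i-j+1≡1+i-j = solve-∀

m≡1+n+o⇒+m-+n-1≡+o : ∀ {m n o} → m ≡ suc (n ℕ.+ o) → + m - + n - + 1 ≡ + o
m≡1+n+o⇒+m-+n-1≡+o {n = n} {o} m≡1+n+o = trans
  (cong (_- + 1) (m≡n+o⇒+m-+n≡+o n (trans m≡1+n+o (sym (ℕ.+-suc n o)))))
  (m≡n+o⇒+m-+n≡+o 1 refl)

module _ {n : ℕ} (G : Instance n) where
  open Instance G

  ℓ*≤ : ∀ (ℓ : Fin n → ℕ) a {c} → (∀ b → T (edge a b) → ℓ b ℕ.≤ c) → ℓ* G ℓ a ℕ.≤ c
  ℓ*≤ ℓ a {c} nbr≤ = foldr-preservesᵇ {P = ℕ._≤ c} ℕ.⊔-lub z≤n (map⁺ (universal entry≤ (allFin n)))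
    where
    entry≤ : ∀ b → (if edge a b then ℓ b else 0) ℕ.≤ c
    entry≤ b with edge a b | nbr≤ b
    ... | true  | ℓb≤c = ℓb≤c tt
    ... | false | _    = z≤n

  WeightBound : (Fin n → ℕ) → Fin n → Fin n → ℕ → Set
  WeightBound ℓ a b m = ∀ b' → T (edge a b') → weight (pref a b' b) (pref a b b') + + ℓ b' ℤ.≤ + m

  module _ {ℓ : Fin n → ℕ} {a b : Fin n} {m : ℕ} (bound : WeightBound ℓ a b m) where

    preferred⇒level< : ∀ {b'} → T (edge a b') → T (pref a b' b) → ℓ b' ℕ.< m
    preferred⇒level< {b'} e = weight+≤⇒< (pref a b' b) (pref a b b') (bound b' e)

    ¬dispreferred⇒level≤ : ∀ {b'} → T (edge a b') → ¬ T (pref a b b') → ℓ b' ℕ.≤ m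
    ¬dispreferred⇒level≤ {b'} e = weight+≤⇒≤ (pref a b' b) (pref a b b') (bound b' e)

    ℓ*≤1+ : ℓ* G ℓ a ℕ.≤ suc m
    ℓ*≤1+ = ℓ*≤ ℓ a (λ b' e → weight+≤⇒≤1+ (pref a b' b) (pref a b b') (bound b' e))

  feasible-from-bound : ∀ (ℓ : Fin n → ℕ) a b {m} λ' → WeightBound ℓ a b m → λ' ℕ.+ ℓ b ≡ m
    → Feasible G ℓ λ' a b
  feasible-from-bound ℓ a b {m} λ' bound load with ℕ.<-cmp (ℓ* G ℓ a) m
  ... | tri< L<m _ _ = inj₁ (m<n+o⇒+m-+n+1≤+o (subst (ℓ* G ℓ a ℕ.<_) (sym load) L<m))
  ... | tri≈ _ L≡m _ = inj₂ (inj₁ (sym (m≡n+o⇒+m-+n≡+o λ' (trans L≡m (sym load))) , no-better-on-top))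
    where
    no-better-on-top : ¬ (∃ λ b' → T (edge a b') × ℓ b' ≡ ℓ* G ℓ a × T (pref a b' b))
    no-better-on-top (b' , e , ℓb'≡L , b'≻b) =
      ℕ.<-irrefl (trans ℓb'≡L L≡m) (preferred⇒level< bound e b'≻b)
  ... | tri> _ _ m<L = inj₂ (inj₂ (sym (m≡1+n+o⇒+m-+n-1≡+o (trans L≡1+m (cong suc (sym load))))
                                   , beats-top , no-better-below-top))
    where
    L≡1+m : ℓ* G ℓ a ≡ suc m
    L≡1+m = ℕ.≤-antisym (ℓ*≤1+ bound) m<L
    beats-top : ∀ b' → T (edge a b') → ℓ b' ≡ ℓ* G ℓ a → T (pref a b b')
    beats-top b' e ℓb'≡L with pref a b b' in eq
    ... | true  = tt
    ... | false = ⊥-elim (ℕ.≤⇒≯ (¬dispreferred⇒level≤ bound e (subst T eq))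
                                 (ℕ.≤-reflexive (sym (trans ℓb'≡L L≡1+m))))
    no-better-below-top : ¬ (∃ λ b'' → T (edge a b'') × + ℓ b'' ≡ + ℓ* G ℓ a - + 1 × T (pref a b'' b))
    no-better-below-top (b'' , e , ℓb''≡L-1 , b''≻b) =
      ℕ.<-irrefl (ℤ.+-injective (trans ℓb''≡L-1 (m≡n+o⇒+m-+n≡+o 1 L≡1+m)))
                 (preferred⇒level< bound e b''≻b)

module _ {n : ℕ} {G : Instance n} {M : Assignment G} {k : ℤ} (α : DualCertificate G M k) where
  open Assignment M
  open DualCertificate α

  αA≡+∣αA∣ : ∀ a → αA a ≡ + ∣ αA a ∣
  αA≡+∣αA∣ a = sym (ℤ.0≤i⇒+∣i∣≡i (proj₁ (αA-range a)))

  αB≡-level : ∀ b → αB b ≡ - + level G α b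
  αB≡-level b = begin
    αB b                 ≡⟨ ℤ.neg-involutive (αB b) ⟨
    - - αB b             ≡⟨ cong -_ (ℤ.0≤i⇒+∣i∣≡i (ℤ.neg-mono-≤ (proj₂ (αB-range b)))) ⟨
    - + ∣ - αB b ∣       ∎
    where open ≡-Reasoning

  αA+αB≡αA-level : ∀ a b → αA a + αB b ≡ + ∣ αA a ∣ - + level G α b
  αA+αB≡αA-level a b = cong₂ _+_ (αA≡+∣αA∣ a) (αB≡-level b)

  dual-weight-bound : ∀ a → WeightBound G (level G α) a (match a) ∣ αA a ∣
  dual-weight-bound a b e = begin
    wt G M a b + + ℓ b                ≤⟨ ℤ.+-monoˡ-≤ (+ ℓ b) (feasible a b e) ⟩
    αA a + αB b + + ℓ b               ≡⟨ cong (_+ + ℓ b) (αA+αB≡αA-level a b) ⟩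
    + ∣ αA a ∣ - + ℓ b + + ℓ b        ≡⟨ i-j+j≡i (+ ∣ αA a ∣) (+ ℓ b) ⟩
    + ∣ αA a ∣                        ∎
    where
    open ℤ.≤-Reasoning
    ℓ : Fin n → ℕ
    ℓ = level G α

  load+level≡∣αA∣ : ∀ a λ' → + λ' ≡ αA a + αB (match a) → λ' ℕ.+ level G α (match a) ≡ ∣ αA a ∣
  load+level≡∣αA∣ a λ' load = ℤ.+-injective (begin
    + λ' + + ℓb                       ≡⟨ cong (_+ + ℓb) (trans load (αA+αB≡αA-level a (match a))) ⟩
    + ∣ αA a ∣ - + ℓb + + ℓb          ≡⟨ i-j+j≡i (+ ∣ αA a ∣) (+ ℓb) ⟩
    + ∣ αA a ∣                        ∎)
    where
    open ≡-Reasoning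
    ℓb : ℕ
    ℓb = level G α (match a)

proposition4 : (n : ℕ) (G : Instance n) (M : Assignment G) (k : ℤ)
    → μ≤ G M k
    → (α : DualCertificate G M k)
    → (a : Fin n) (λ' : ℕ)
    → + λ' ≡ DualCertificate.αA α a + DualCertificate.αB α (Assignment.match M a)
    → Feasible G (level G α) λ' a (Assignment.match M a)
proposition4 n G M k _ α a λ' load =
  feasible-from-bound G (level G α) a (Assignment.match M a) λ'
    (dual-weight-bound α a) (load+level≡∣αA∣ α a λ' load)
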